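{- Let $u_1,\dots,u_J$ be coupled nodes of $\mathcal P$ all at the same level, and let $\mathcal T$ be the subpedigree of $\mathcal P$ induced by the set of all ancestors of $u_1,\dots,u_J$. For $j\ge0$ let $k_j$ be the number of nodes of $\mathcal T$ with outdegree $j$ in $\mathcal T$ (edges counted with multiplicity). Then \[\mathrm{coll}(u_1,\dots,u_J)=\sum_{j\ge2}(j-1)k_j.\]
   Context: $\mathcal P$ is a coupled pedigree arising from the following model (any realization). Individuals lie in levels $T$ (founders), $T-1,\dots,0$ (extant). At each level $i\ge1$ individuals are matched into couples (at most one individual left unmatched, having no children), and each couple has some number of children at level $i-1$. The coupled pedigree $\mathcal P$ has as nodes ("coupled nodes") at level $i\ge1$ the couples of level $i$ and at level $0$ the extant individuals; a level-$(i-1)$ coupled node $c$ receives one edge from the parent couple of each individual in $c$ (so an extant node has exactly one parent edge, and a non-founder couple has two parent edges, which form a double edge if both its members have the same parent couple). Every node is its own ancestor; $\mathrm{anc}_i(u)$ denotes the set of ancestors of $u$ exactly $i$ levels above $u$. Collisions: for a set $A$ of coupled nodes at level $k<T$, with $\mathrm{par}(A)$ the set of parents of nodes of $A$, define $\mathrm{coll}_{k+1}(A)=2|A|-|\mathrm{par}(A)|$ if $k>0$ and $\mathrm{coll}_{1}(A)=|A|-|\mathrm{par}(A)|$ if $k=0$. For nodes $u_1,\dots,u_J$ at level $k$, $\mathrm{coll}(u_1,\dots,u_J)=\sum_{i=0}^{T-k-1}\mathrm{coll}_{k+i+1}\big(\mathrm{anc}_i(u_1)\cup\dots\cup\mathrm{anc}_i(u_J)\big)$.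 -}

module Defs where

open import Data.Nat using (ℕ; zero; suc; _+_; _*_; _∸_; _≤_; _<_; _≡ᵇ_)
open import Data.Nat.Properties using (<⇒≤; m≤o∸n⇒m+n≤o)
open import Data.Fin using (Fin; toℕ; zero; suc; _≟_)
open import Data.Fin.Properties using (toℕ<n)
open import Data.Bool using (Bool; true; false; if_then_else_; _∧_; _∨_; not)
open import Data.List using (List; []; _∷_)
open import Data.Product using (_×_)
open import Data.Integer using (ℤ; +_; _-_)
import Data.Integer as ℤ
open import Relation.Nullary using (does)
open import Relation.Binary.PropositionalEquality using (_≡_)

sumFin : (n : ℕ) → (Fin n → ℕ) → ℕ
sumFin zero    f = 0
sumFin (suc n) f = f zero + sumFin n (λ x → f (suc x))

sumFinℤ : (n : ℕ) → (Fin n → ℤ) → ℤ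
sumFinℤ zero    f = + 0
sumFinℤ (suc n) f = f zero ℤ.+ sumFinℤ n (λ x → f (suc x))

anyFin : (n : ℕ) → (Fin n → Bool) → Bool
anyFin zero    f = false
anyFin (suc n) f = f zero ∨ anyFin n (λ x → f (suc x))

card : {n : ℕ} → (Fin n → Bool) → ℕ
card {n} A = sumFin n (λ x → if A x then 1 else 0)

-- Levels are 0 (extant), ..., T (founders).
-- ind i  = number of individuals at level i (individuals are Fin (ind i)),
-- cpl i  = number of couples at level i (meaningful for 1 ≤ i ≤ T),
-- mem i c b = the b-th member (b ∈ {0,1}) of couple c at level i,
-- parent i x = the parent couple (at level i+1) of individual x at level i < T.
-- Data at levels > T, and cpl 0, are never used.

record Pedigree (T : ℕ) : Set where
  field
    ind    : ℕ → ℕ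
    cpl    : ℕ → ℕ
    mem    : (i : ℕ) → Fin (cpl i) → Fin 2 → Fin (ind i)
    mem-inj : ∀ i → 1 ≤ i → i ≤ T → ∀ c c′ b b′ →
              mem i c b ≡ mem i c′ b′ → (c ≡ c′) × (b ≡ b′)
    unmatched≤1 : ∀ i → 1 ≤ i → i ≤ T → ind i ≤ suc (2 * cpl i)
    parent : (i : ℕ) → i < T → Fin (ind i) → Fin (cpl (suc i))

module _ {T : ℕ} (P : Pedigree T) where
  open Pedigree P

  -- number of coupled nodes at level l: extant individuals at level 0,
  -- couples at levels ≥ 1
  size : ℕ → ℕ
  size zero    = ind 0
  size (suc l) = cpl (suc l)

  CN : ℕ → Set
  CN l = Fin (size l)

  parents : (l : ℕ) → l < T → CN l → List (CN (suc l))
  parents zero    h x = parent 0 h x ∷ []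
  parents (suc l) h c =
    parent (suc l) h (mem (suc l) c zero) ∷ parent (suc l) h (mem (suc l) c (suc zero)) ∷ []

  mult : {n : ℕ} → Fin n → List (Fin n) → ℕ
  mult v []       = 0
  mult v (w ∷ ws) = (if does (v ≟ w) then 1 else 0) + mult v ws

  edges : (l : ℕ) → l < T → CN (suc l) → CN l → ℕ
  edges l h v x = mult v (parents l h x)

  parSet : (l : ℕ) → l < T → (CN l → Bool) → (CN (suc l) → Bool)
  parSet l h A v = anyFin (size l) (λ x → A x ∧ not (edges l h v x ≡ᵇ 0))

  ancs : (k i : ℕ) → i + k ≤ T → (CN k → Bool) → (CN (i + k) → Bool)
  ancs k zero    h A = A
  ancs k (suc i) h A = parSet (i + k) h (ancs k i (<⇒≤ h) A)

  -- coll_{l+1}(A) for A a set of coupled nodes at level l < T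
  collAt : (l : ℕ) → l < T → (CN l → Bool) → ℤ
  collAt zero    h A = + card A - + card (parSet zero h A)
  collAt (suc l) h A = + (2 * card A) - + card (parSet (suc l) h A)

  setOf : (k : ℕ) {J : ℕ} → (Fin J → CN k) → (CN k → Bool)
  setOf k {J} u v = anyFin J (λ j → does (u j ≟ v))

  lvl< : (k : ℕ) → k ≤ T → (i : Fin (T ∸ k)) → toℕ i + k < T
  lvl< k k≤T i = m≤o∸n⇒m+n≤o (suc (toℕ i)) k≤T (toℕ<n i)

  lvl≤ : (k : ℕ) → k ≤ T → (i : Fin (suc (T ∸ k))) → toℕ i + k ≤ T
  lvl≤ k k≤T i = m≤o∸n⇒m+n≤o (toℕ i) k≤T (Data.Nat.Properties.≤-pred (toℕ<n i))
    where import Data.Nat.Properties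

  coll : (k : ℕ) → k ≤ T → {J : ℕ} → (Fin J → CN k) → ℤ
  coll k k≤T u = sumFinℤ (T ∸ k) (λ i →
    collAt (toℕ i + k) (lvl< k k≤T i) (ancs k (toℕ i) (<⇒≤ (lvl< k k≤T i)) (setOf k u)))

  -- The subpedigree 𝒯 induced by all ancestors of u_1..u_J (level k):
  -- its nodes at level i + k (0 ≤ i ≤ T - k) are anc_i({u_1..u_J}).
  inTree : (k : ℕ) → k ≤ T → {J : ℕ} → (Fin J → CN k) →
           (i : Fin (suc (T ∸ k))) → CN (toℕ i + k) → Bool
  inTree k k≤T u i = ancs k (toℕ i) (lvl≤ k k≤T i) (setOf k u)

  -- outdegree in 𝒯 (edges with multiplicity) of a node v at level i + k:
  -- the number of edges from v to the nodes of 𝒯 at level i + k - 1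
  -- (nodes at level k have no children in 𝒯).
  outdegAux : (k i : ℕ) → i + k ≤ T → {J : ℕ} → (Fin J → CN k) → CN (i + k) → ℕ
  outdegAux k zero    h u v = 0
  outdegAux k (suc i) h u v =
    sumFin (size (i + k)) (λ x →
      if ancs k i (<⇒≤ h) (setOf k u) x then edges (i + k) h v x else 0)

  outdeg : (k : ℕ) → (k≤T : k ≤ T) → {J : ℕ} → (u : Fin J → CN k) →
           (i : Fin (suc (T ∸ k))) → CN (toℕ i + k) → ℕ
  outdeg k k≤T u i = outdegAux k (toℕ i) (lvl≤ k k≤T i) u

  kCount : (k : ℕ) → k ≤ T → {J : ℕ} → (Fin J → CN k) → ℕ → ℕ
  kCount k k≤T u j = sumFin (suc (T ∸ k)) (λ i →
    card (λ v → inTree k k≤T u i v ∧ (outdeg k k≤T u i v ≡ᵇ j)))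

  -- total number of edges of 𝒯 (an upper bound for every outdegree in 𝒯,
  -- so k_j = 0 for all j > numEdges)
  numEdges : (k : ℕ) → k ≤ T → {J : ℕ} → (Fin J → CN k) → ℕ
  numEdges k k≤T u = sumFin (suc (T ∸ k)) (λ i →
    sumFin (size (toℕ i + k)) (λ v →
      if inTree k k≤T u i v then outdeg k k≤T u i v else 0))

  -- Σ_{j ≥ 2} (j - 1) k_j  (the sum runs over 2 ≤ j ≤ numEdges; all other terms vanish)
  excessSum : (k : ℕ) → k ≤ T → {J : ℕ} → (Fin J → CN k) → ℕ
  excessSum k k≤T u = sumFin (numEdges k k≤T u ∸ 1) (λ j →
    (toℕ j + 1) * kCount k k≤T u (toℕ j + 2))

module Submission where

-- Proof idea.  Write E_A(v) for the number of edges (with multiplicity)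
-- from a node v at level l+1 into a node set A at level l.
--
-- (1) Per level: Σ_v E_A(v) counts every parent edge of A once, i.e. it is
--     |A| at level 0 and 2|A| above; and par(A) is exactly the set of v with
--     E_A(v) ≠ 0.  Writing each term as E = (E ∸ 1) + [E ≠ 0] gives
--         coll_{l+1}(A) = Σ_v (E_A(v) ∸ 1).
-- (2) In the ancestral subpedigree 𝒯 the outdegree of a node v one level
--     above anc_i is E_{anc_i}(v), so summing (1) over the levels gives
--         coll(u_1..u_J) = Σ_{v ∈ 𝒯} (outdeg v ∸ 1)
--     (the bottom level, having outdegree 0, contributes nothing).
-- (3) Σ_{j ≥ 2} (j-1) k_j regroups, node by node, into the same sum, since a
--     node of outdegree d contributes Σ_j (j-1)[d = j] = d ∸ 1.

open import Defs
open import Data.Nat using (ℕ; _≤_)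
open import Data.Fin using (Fin)
open import Data.Integer using (+_)
open import Relation.Binary.PropositionalEquality using (_≡_)

open import Data.Nat using (zero; suc; _+_; _*_; _∸_; _<_; _≡ᵇ_; s≤s)
open import Data.Nat.Properties
  using (+-*-semiring; +-comm; +-identityʳ; *-identityʳ; *-zeroʳ; m≤m+n; m≤n+m;
         ≤-trans; ≤-refl; m≤n+m∸n; m+n∸n≡m; <⇒≤; <-irrelevant)
open import Data.Fin using (toℕ; zero; suc; _≟_)
open import Data.Bool using (Bool; true; false; if_then_else_; _∧_; not)
open import Data.List using (List; []; _∷_; length)
open import Data.Integer using (ℤ)
import Data.Integer as ℤ
import Data.Integer.Properties as ℤ
open import Function using (_∘_)
open import Relation.Nullary using (does)
open import Relation.Binary.PropositionalEquality using (refl; sym; trans; cong; cong₂; module ≡-Reasoning)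
open import Algebra.Properties.Semiring.Sum +-*-semiring
  using (sum-syntax; sum-cong-≗; ∑-distrib-+; ∑-comm; *-distribˡ-sum)

open ≡-Reasoning

-- sumFin is the library's ∑ over the semiring ℕ (same recursion), so the
-- library's summation laws transfer to it.
sumFin≡∑ : ∀ n (f : Fin n → ℕ) → sumFin n f ≡ ∑[ i < n ] f i
sumFin≡∑ zero    f = refl
sumFin≡∑ (suc n) f = cong (_+_ (f zero)) (sumFin≡∑ n (f ∘ suc))

sumFin-cong : ∀ n {f g : Fin n → ℕ} → (∀ x → f x ≡ g x) → sumFin n f ≡ sumFin n g
sumFin-cong n {f} {g} f≗g = begin
  sumFin n f     ≡⟨ sumFin≡∑ n f ⟩
  ∑[ i < n ] f i ≡⟨ sum-cong-≗ f≗g ⟩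
  ∑[ i < n ] g i ≡⟨ sumFin≡∑ n g ⟨
  sumFin n g     ∎

sumFin-+ : ∀ n (f g : Fin n → ℕ) → sumFin n (λ x → f x + g x) ≡ sumFin n f + sumFin n g
sumFin-+ n f g = begin
  sumFin n (λ x → f x + g x)     ≡⟨ sumFin≡∑ n _ ⟩
  ∑[ i < n ] (f i + g i)         ≡⟨ ∑-distrib-+ f g ⟩
  ∑[ i < n ] f i + ∑[ i < n ] g i ≡⟨ cong₂ _+_ (sumFin≡∑ n f) (sumFin≡∑ n g) ⟨
  sumFin n f + sumFin n g        ∎

*-distribˡ-sumFin : ∀ n c (f : Fin n → ℕ) → c * sumFin n f ≡ sumFin n (λ x → c * f x)
*-distribˡ-sumFin n c f = begin
  c * sumFin n f            ≡⟨ cong (c *_) (sumFin≡∑ n f) ⟩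
  c * ∑[ i < n ] f i        ≡⟨ *-distribˡ-sum c f ⟩
  ∑[ i < n ] (c * f i)      ≡⟨ sumFin≡∑ n _ ⟨
  sumFin n (λ x → c * f x)  ∎

sumFin-swap : ∀ n m (g : Fin n → Fin m → ℕ) →
  sumFin n (λ j → sumFin m (g j)) ≡ sumFin m (λ i → sumFin n (λ j → g j i))
sumFin-swap n m g = begin
  sumFin n (λ j → sumFin m (g j))           ≡⟨ double n m g ⟩
  ∑[ j < n ] ∑[ i < m ] g j i               ≡⟨ ∑-comm g ⟩
  ∑[ i < m ] ∑[ j < n ] g j i               ≡⟨ double m n (λ i j → g j i) ⟨
  sumFin m (λ i → sumFin n (λ j → g j i))   ∎
  where
  double : ∀ n m (g : Fin n → Fin m → ℕ) →
    sumFin n (λ j → sumFin m (g j)) ≡ ∑[ j < n ] ∑[ i < m ] g j i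
  double n m g = trans (sumFin≡∑ n _) (sum-cong-≗ (λ j → sumFin≡∑ m (g j)))

sumFin-zero : ∀ n {f : Fin n → ℕ} → (∀ x → f x ≡ 0) → sumFin n f ≡ 0
sumFin-zero zero    f≗0 = refl
sumFin-zero (suc n) f≗0 = cong₂ _+_ (f≗0 zero) (sumFin-zero n (f≗0 ∘ suc))

term≤sumFin : ∀ n (f : Fin n → ℕ) x → f x ≤ sumFin n f
term≤sumFin (suc n) f zero    = m≤m+n (f zero) _
term≤sumFin (suc n) f (suc x) = ≤-trans (term≤sumFin n (f ∘ suc) x) (m≤n+m _ (f zero))

sumFinℤ-pos : ∀ n {f : Fin n → ℤ} {g : Fin n → ℕ} →
  (∀ x → f x ≡ + g x) → sumFinℤ n f ≡ + sumFin n g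
sumFinℤ-pos zero    f≗g = refl
sumFinℤ-pos (suc n) {g = g} f≗g =
  trans (cong₂ ℤ._+_ (f≗g zero) (sumFinℤ-pos n (f≗g ∘ suc)))
        (sym (ℤ.pos-+ (g zero) (sumFin n (g ∘ suc))))

sumFin-if : ∀ n (b : Bool) (f : Fin n → ℕ) →
  sumFin n (λ x → if b then f x else 0) ≡ (if b then sumFin n f else 0)
sumFin-if n true  f = refl
sumFin-if n false f = sumFin-zero n (λ _ → refl)

any-nonzero : ∀ n (A : Fin n → Bool) (g : Fin n → ℕ) →
  anyFin n (λ x → A x ∧ not (g x ≡ᵇ 0)) ≡ not (sumFin n (λ x → if A x then g x else 0) ≡ᵇ 0)
any-nonzero zero    A g = refl
any-nonzero (suc n) A g with A zero | g zero
... | false | _     = any-nonzero n (A ∘ suc) (g ∘ suc)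
... | true  | zero  = any-nonzero n (A ∘ suc) (g ∘ suc)
... | true  | suc _ = refl

sumFin-point : ∀ m (w : Fin m) → sumFin m (λ v → if does (v ≟ w) then 1 else 0) ≡ 1
sumFin-point (suc m) zero    = cong suc (sumFin-zero m (λ _ → refl))
sumFin-point (suc m) (suc w) = sumFin-point m w

sumFin-δ : ∀ M (g : ℕ → ℕ) e → e < M →
  sumFin M (λ j → if e ≡ᵇ toℕ j then g (toℕ j) else 0) ≡ g e
sumFin-δ (suc M) g zero    _         = trans (cong (_+_ (g 0)) (sumFin-zero M (λ _ → refl))) (+-identityʳ (g 0))
sumFin-δ (suc M) g (suc e) (s≤s e<M) = sumFin-δ M (g ∘ suc) e e<M

double-card : ∀ {n} (A : Fin n → Bool) → 2 * card A ≡ sumFin n (λ x → if A x then 2 else 0)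
double-card {n} A = trans (*-distribˡ-sumFin n 2 _) (sumFin-cong n (λ x → double (A x)))
  where
  double : ∀ b → 2 * (if b then 1 else 0) ≡ (if b then 2 else 0)
  double true  = refl
  double false = refl

-- Each term splits as f = (f ∸ 1) + [f ≠ 0], so
-- Σ f = Σ (f ∸ 1) + #{x | f x ≠ 0}.
sumFin-split-positive : ∀ n (f : Fin n → ℕ) →
  sumFin n f ≡ sumFin n (λ x → f x ∸ 1) + card (λ x → not (f x ≡ᵇ 0))
sumFin-split-positive n f = trans (sumFin-cong n (λ x → split (f x))) (sumFin-+ n _ _)
  where
  split : ∀ m → m ≡ (m ∸ 1) + (if not (m ≡ᵇ 0) then 1 else 0)
  split zero    = refl
  split (suc m) = +-comm 1 m

*-indicator : ∀ n b → n * (if b then 1 else 0) ≡ (if b then n else 0)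
*-indicator n true  = *-identityʳ n
*-indicator n false = *-zeroʳ n

-- Moving the offset 2 to the left lets `_≡ᵇ_` compute on it.
weight-cong : ∀ {M} d (j : Fin M) →
  (toℕ j + 1) * (if d ≡ᵇ toℕ j + 2 then 1 else 0) ≡ (toℕ j + 1) * (if d ≡ᵇ 2 + toℕ j then 1 else 0)
weight-cong d j = cong (λ n → (toℕ j + 1) * (if d ≡ᵇ n then 1 else 0)) (+-comm (toℕ j) 2)

excessOfDegree : ∀ M d → d ≤ suc M →
  sumFin M (λ j → (toℕ j + 1) * (if d ≡ᵇ toℕ j + 2 then 1 else 0)) ≡ d ∸ 1
excessOfDegree M zero          _ =
  sumFin-zero M (λ j → trans (weight-cong 0 j) (*-zeroʳ (toℕ j + 1)))
excessOfDegree M (suc zero)    _ =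
  sumFin-zero M (λ j → trans (weight-cong 1 j) (*-zeroʳ (toℕ j + 1)))
excessOfDegree M (suc (suc e)) (s≤s e<M) = begin
  sumFin M (λ j → (toℕ j + 1) * (if suc (suc e) ≡ᵇ toℕ j + 2 then 1 else 0))
    ≡⟨ sumFin-cong M (λ j → trans (weight-cong (suc (suc e)) j) (*-indicator (toℕ j + 1) (e ≡ᵇ toℕ j))) ⟩
  sumFin M (λ j → if e ≡ᵇ toℕ j then toℕ j + 1 else 0)
    ≡⟨ sumFin-δ M (_+ 1) e e<M ⟩
  e + 1
    ≡⟨ +-comm e 1 ⟩
  suc e ∎

excessOfNode : ∀ M t d → (t ≡ false → d ≡ 0) → d ≤ suc M →
  sumFin M (λ j → (toℕ j + 1) * (if t ∧ (d ≡ᵇ toℕ j + 2) then 1 else 0)) ≡ d ∸ 1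
excessOfNode M true  d _   d≤ = excessOfDegree M d d≤
excessOfNode M false d off _  =
  trans (sumFin-zero M (λ j → *-zeroʳ (toℕ j + 1))) (cong (_∸ 1) (sym (off refl)))

module Levels {T : ℕ} (P : Pedigree T) where
  open Pedigree P

  edgesInto : (l : ℕ) → l < T → (CN P l → Bool) → CN P (suc l) → ℕ
  edgesInto l h A v = sumFin (size P l) (λ x → if A x then edges P l h v x else 0)

  parSet≡hasEdge : ∀ l (h : l < T) A v → parSet P l h A v ≡ not (edgesInto l h A v ≡ᵇ 0)
  parSet≡hasEdge l h A v = any-nonzero (size P l) A (edges P l h v)

  -- Every listed parent edge is counted by exactly one node of the level above.
  sumFin-mult : ∀ m (L : List (Fin m)) → sumFin m (λ v → mult P v L) ≡ length L
  sumFin-mult m []       = sumFin-zero m (λ _ → refl)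
  sumFin-mult m (w ∷ ws) = trans (sumFin-+ m _ _) (cong₂ _+_ (sumFin-point m w) (sumFin-mult m ws))

  sumFin-edgesInto : ∀ l (h : l < T) A →
    sumFin (size P (suc l)) (edgesInto l h A)
      ≡ sumFin (size P l) (λ x → if A x then length (parents P l h x) else 0)
  sumFin-edgesInto l h A = trans (sumFin-swap (size P (suc l)) (size P l) _)
    (sumFin-cong (size P l) (λ x →
      trans (sumFin-if (size P (suc l)) (A x) (λ v → edges P l h v x))
            (cong (λ n → if A x then n else 0) (sumFin-mult _ (parents P l h x)))))

  -- coll_{l+1}(A) = (parent edges of A) − |par(A)|: an extant node has one
  -- parent edge, a couple has two.
  collAt≡edges−parents : ∀ l (h : l < T) A →
    collAt P l h A ≡ + sumFin (size P l) (λ x → if A x then length (parents P l h x) else 0)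
                     ℤ.- + card (parSet P l h A)
  collAt≡edges−parents zero    h A = refl
  collAt≡edges−parents (suc l) h A =
    cong (λ n → + n ℤ.- + card (parSet P (suc l) h A)) (double-card A)

  collAt≡excess : ∀ l (h : l < T) A →
    collAt P l h A ≡ + sumFin (size P (suc l)) (λ v → edgesInto l h A v ∸ 1)
  collAt≡excess l h A = begin
    collAt P l h A
      ≡⟨ collAt≡edges−parents l h A ⟩
    + sumFin _ (λ x → if A x then length (parents P l h x) else 0) ℤ.- + |par|
      ≡⟨ cong (λ n → + n ℤ.- + |par|) (sym (sumFin-edgesInto l h A)) ⟩
    + sumFin _ E ℤ.- + |par|
      ≡⟨ cong (λ n → + n ℤ.- + |par|) (sumFin-split-positive _ E) ⟩
    + (excess + card (λ v → not (E v ≡ᵇ 0))) ℤ.- + |par|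
      ≡⟨ cong (λ n → + (excess + n) ℤ.- + |par|) (sym |par|≡) ⟩
    + (excess + |par|) ℤ.- + |par|
      ≡⟨ ℤ.[+m]-[+n]≡m⊖n (excess + |par|) |par| ⟩
    (excess + |par|) ℤ.⊖ |par|
      ≡⟨ ℤ.≤-⊖ (m≤n+m |par| excess) ⟩
    + (excess + |par| ∸ |par|)
      ≡⟨ cong +_ (m+n∸n≡m excess |par|) ⟩
    + excess ∎
    where
    E : CN P (suc l) → ℕ
    E = edgesInto l h A
    excess |par| : ℕ
    excess = sumFin _ (λ v → E v ∸ 1)
    |par| = card (parSet P l h A)
    |par|≡ : |par| ≡ card (λ v → not (E v ≡ᵇ 0))
    |par|≡ = sumFin-cong _ (λ v → cong (λ b → if b then 1 else 0) (parSet≡hasEdge l h A v))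

module Tree {T : ℕ} (P : Pedigree T) (k : ℕ) (k≤T : k ≤ T) {J : ℕ} (u : Fin J → CN P k) where
  open Levels P

  S : CN P k → Bool
  S = setOf P k u

  treeExcess : ℕ
  treeExcess = sumFin (suc (T ∸ k)) (λ i →
    sumFin (size P (toℕ i + k)) (λ v → outdeg P k k≤T u i v ∸ 1))

  -- Nodes outside 𝒯 have no children in 𝒯: above the bottom level a node is
  -- in 𝒯 iff it has an edge into the level below.
  offTree-outdeg : ∀ i v → inTree P k k≤T u i v ≡ false → outdeg P k k≤T u i v ≡ 0
  offTree-outdeg zero    v _   = refl
  offTree-outdeg (suc i) v off =
    noEdge _ (trans (sym (parSet≡hasEdge _ (lvl≤ P k k≤T (suc i)) _ v)) off)
    where
    noEdge : ∀ n → not (n ≡ᵇ 0) ≡ false → n ≡ 0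
    noEdge zero _ = refl

  outdeg≤numEdges : ∀ i v → outdeg P k k≤T u i v ≤ numEdges P k k≤T u
  outdeg≤numEdges i v = ≤-trans (≤-trans (reflexive-if (inTree P k k≤T u i v) (offTree-outdeg i v))
      (term≤sumFin _ (treeOutdeg i) v))
    (term≤sumFin (suc (T ∸ k)) (λ i′ → sumFin (size P (toℕ i′ + k)) (treeOutdeg i′)) i)
    where
    treeOutdeg : (i : Fin (suc (T ∸ k))) → CN P (toℕ i + k) → ℕ
    treeOutdeg i w = if inTree P k k≤T u i w then outdeg P k k≤T u i w else 0

    reflexive-if : ∀ t {d} → (t ≡ false → d ≡ 0) → d ≤ (if t then d else 0)
    reflexive-if true  _   = ≤-refl
    reflexive-if false off rewrite off refl = ≤-refl

  -- (2): coll(u_1..u_J) = Σ_{v ∈ 𝒯} (outdeg v ∸ 1).  Level i of the collision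
  -- sum is (1) for A = anc_i, whose E_A is the outdegree at tree level i+1;
  -- the bottom tree level has outdegree 0.
  coll≡treeExcess : coll P k k≤T u ≡ + treeExcess
  coll≡treeExcess = begin
    coll P k k≤T u
      ≡⟨ sumFinℤ-pos (T ∸ k) level ⟩
    + upperLevels
      ≡⟨ cong (λ n → + (n + upperLevels)) (sym (sumFin-zero (size P k) (λ _ → refl))) ⟩
    + treeExcess ∎
    where
    upperLevels : ℕ
    upperLevels = sumFin (T ∸ k) (λ i → sumFin _ (λ v → outdeg P k k≤T u (suc i) v ∸ 1))
    level : ∀ i → collAt P (toℕ i + k) (lvl< P k k≤T i) (ancs P k (toℕ i) (<⇒≤ (lvl< P k k≤T i)) S)
                ≡ + sumFin _ (λ v → outdeg P k k≤T u (suc i) v ∸ 1)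
    level i = trans
      (cong (λ h → collAt P (toℕ i + k) h (ancs P k (toℕ i) (<⇒≤ h) S))
            (<-irrelevant (lvl< P k k≤T i) (lvl≤ P k k≤T (suc i))))
      (collAt≡excess _ (lvl≤ P k k≤T (suc i)) _)

  -- (3): Σ_{j≥2} (j-1) k_j = Σ_{v ∈ 𝒯} (outdeg v ∸ 1), by expanding k_j as a
  -- sum over the nodes of 𝒯 and summing over j first.
  excessSum≡treeExcess : excessSum P k k≤T u ≡ treeExcess
  excessSum≡treeExcess = begin
    sumFin M (λ j → (toℕ j + 1) * kCount P k k≤T u (toℕ j + 2))
      ≡⟨ sumFin-cong M (λ j → trans (*-distribˡ-sumFin L (toℕ j + 1) (λ i → card (isDeg j i)))
           (sumFin-cong L (λ i → *-distribˡ-sumFin (size P (toℕ i + k)) (toℕ j + 1)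
                                   (λ v → if isDeg j i v then 1 else 0)))) ⟩
    sumFin M (λ j → sumFin L (λ i → sumFin (size P (toℕ i + k)) (contribution j i)))
      ≡⟨ sumFin-swap M L (λ j i → sumFin (size P (toℕ i + k)) (contribution j i)) ⟩
    sumFin L (λ i → sumFin M (λ j → sumFin (size P (toℕ i + k)) (contribution j i)))
      ≡⟨ sumFin-cong L (λ i → sumFin-swap M (size P (toℕ i + k)) (λ j → contribution j i)) ⟩
    sumFin L (λ i → sumFin (size P (toℕ i + k)) (λ v → sumFin M (λ j → contribution j i v)))
      ≡⟨ sumFin-cong L (λ i → sumFin-cong _ (λ v →
           excessOfNode M (inTree P k k≤T u i v) (outdeg P k k≤T u i v) (offTree-outdeg i v)
             (≤-trans (outdeg≤numEdges i v) (m≤n+m∸n (numEdges P k k≤T u) 1)))) ⟩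
    treeExcess ∎
    where
    M L : ℕ
    M = numEdges P k k≤T u ∸ 1
    L = suc (T ∸ k)
    isDeg : (j : Fin M) (i : Fin L) → CN P (toℕ i + k) → Bool
    isDeg j i v = inTree P k k≤T u i v ∧ (outdeg P k k≤T u i v ≡ᵇ toℕ j + 2)
    contribution : (j : Fin M) (i : Fin L) → CN P (toℕ i + k) → ℕ
    contribution j i v = (toℕ j + 1) * (if isDeg j i v then 1 else 0)

mainTheorem4 : (T : ℕ) (P : Pedigree T) (k : ℕ) (k≤T : k ≤ T) (J : ℕ)
    (u : Fin J → CN P k) →
    coll P k k≤T u ≡ + excessSum P k k≤T u
mainTheorem4 T P k k≤T J u = begin
  coll P k k≤T u          ≡⟨ coll≡treeExcess ⟩
  + treeExcess            ≡⟨ cong +_ excessSum≡treeExcess ⟨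
  + excessSum P k k≤T u   ∎
  where open Tree P k k≤T u
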